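{- Let $n\geq 3$ be odd, and consider any directed Hamiltonian cycle of $\mathcal{A}_n$. For every $i\in[n]$ there exists a permutation $\pi\in A_n$ with $\pi(n)=i$ such that the edge of the cycle leaving $\pi$ is a $\tau_n$-edge (i.e. goes from $\pi$ to $\pi\tau_n$).
   Context: Permutations of $[n]=\{1,\ldots,n\}$ are written $\pi=[\pi(1),\ldots,\pi(n)]$ with composition $(\pi\rho)(i)=\pi(\rho(i))$. For $2\leq k\leq n$, $\tau_k:=[k,1,2,\ldots,k-1,k+1,\ldots,n]$. $\mathcal{A}_n$ is the directed Cayley graph with vertex set the alternating group $A_n$ and a directed edge labelled $\tau_k$ from $\pi$ to $\pi\tau_k$ for each $\pi\in A_n$ and each odd $k\in\{3,5,\ldots,n\}$. -}

module Defs where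

open import Data.Nat using (ℕ; zero; suc; _∸_; _≤_; _<?_)
open import Data.Nat.Divisibility using (_∣_)
open import Data.Fin using (Fin; zero; suc; toℕ; fromℕ<; inject₁) renaming (_<?_ to _<ᶠ?_)
open import Data.Vec using (Vec; []; _∷_; lookup; tabulate; count)
open import Data.Product using (∃; _×_)
open import Relation.Binary.PropositionalEquality using (_≡_)
open import Relation.Nullary using (¬_; yes; no)

-- Permutations of [n] in one-line notation: position j (0-based) holds π(j+1)-1.
Word : ℕ → Set
Word n = Vec (Fin n) n

IsPerm : ∀ {n} → Word n → Set
IsPerm {n} π = ∀ (i j : Fin n) → lookup π i ≡ lookup π j → i ≡ j

inversions : ∀ {m} {n} → Vec (Fin n) m → ℕ
inversions [] = 0
inversions (x ∷ xs) = count (λ y → y <ᶠ? x) xs Data.Nat.+ inversions xs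

InA : ∀ {n} → Word n → Set
InA π = IsPerm π × (2 ∣ inversions π)

-- τ_k as a function (0-based): 0 ↦ k-1, j ↦ j-1 for 1 ≤ j ≤ k-1, j ↦ j otherwise
tau : ∀ {n} → ℕ → Fin n → Fin n
tau {suc m} k zero with k ∸ 1 <? suc m
... | yes p = fromℕ< p
... | no _ = zero
tau {suc m} k (suc j) with toℕ (suc j) <? k
... | yes _ = inject₁ j
... | no _ = suc j

_·τ_ : ∀ {n} → Word n → ℕ → Word n
π ·τ k = tabulate (λ i → lookup π (tau k i))

OddGen : ℕ → ℕ → Set
OddGen n k = 3 ≤ k × k ≤ n × ¬ (2 ∣ k)

iter : ∀ {A : Set} → (A → A) → ℕ → A → A
iter f zero x = x
iter f (suc m) x = f (iter f m x)

-- A directed Hamiltonian cycle of the Cayley graph 𝒜_n, given by its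
-- successor map: every edge π → next π of the cycle is an edge π → π τ_k
-- (k odd, 3 ≤ k ≤ n), and the cycle passes through every vertex of A_n
-- (every vertex is reached from every other by following the cycle).
record HamCycle (n : ℕ) : Set where
  field
    next    : Word n → Word n
    isEdge  : ∀ π → InA π → ∃ λ k → OddGen n k × next π ≡ π ·τ k
    covers  : ∀ π ρ → InA π → InA ρ → ∃ λ m → iter next m π ≡ ρ

LastValue : ∀ {n} → Word n → Fin n → Set
LastValue {n} π i = ∃ λ j → toℕ j ≡ n ∸ 1 × lookup π j ≡ i

module Submission where

-- For k < n the rotation τ_k fixes position n, so along the
-- Hamiltonian cycle the last entry π(n) can only change across a τ_n-edge.
-- Fix i.  The even permutation π₀ = id·τ_n^(n-i) has π₀(n) = i, while its
-- τ_n-neighbour ρ = π₀τ_n has ρ(n) = π₀(n-1) ≠ i.  The cycle leads from π₀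
-- to ρ, so at some vertex π of the walk the last entry changes from i to
-- something else; the edge leaving that π is then a τ_n-edge.
--
-- Since the cycle is only known to move along edges at vertices of A_n, we
-- also need that A_n is closed under τ_k for odd k.  For this τ_{k+1} is
-- identified with the rotation bringing the entry at position k to the
-- front; such a rotation is a product of k adjacent transpositions of
-- distinct entries, each of which flips the parity of the number of
-- inversions.

open import Defs
open import Data.Nat using (ℕ; zero; suc; _+_; _*_; _∸_; _≤_; _<_; z≤n; s≤s; parity)
  renaming (_<?_ to _<ℕ?_)
open import Data.Nat.Properties
  using (≤-antisym; ≤-refl; <-asym; ≤∧≢⇒<; 1+n≰n; ≮⇒≥; <⇒≱; ≤⇒≯; <⇒≢; m≤n⇒m≤1+n; <-irrefl; n<1+n; ≤-pred;
         +-identityʳ; +-suc; suc-injective; m+[n∸m]≡n; +-commutativeSemigroup)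
open import Algebra.Properties.CommutativeSemigroup +-commutativeSemigroup using (x∙yz≈y∙xz)
open import Data.Nat.Divisibility using (_∣_; divides; _∣0)
open import Data.Parity.Base as ℙ using (0ℙ; 1ℙ)
open import Data.Parity.Properties using (+-homo-+; suc-homo-⁻¹; ⁻¹-injective)
open import Data.Fin using (Fin; zero; suc; toℕ; fromℕ; fromℕ<; inject₁) renaming (_<?_ to _<ᶠ?_)
open import Data.Fin.Properties
  using (toℕ-injective; toℕ-inject₁; toℕ-fromℕ; toℕ-fromℕ<; toℕ<n)
  renaming (_≟_ to _≟ᶠ_; suc-injective to fsuc-injective)
open import Data.Vec using (Vec; []; _∷_; lookup; tabulate; count; allFin)
open import Data.Vec.Properties using (lookup∘tabulate; tabulate-cong; tabulate∘lookup; lookup-allFin)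
open import Data.Bool using (true; false; if_then_else_)
open import Data.Product using (∃; _×_; _,_; proj₁; proj₂)
open import Data.Sum using (_⊎_; inj₁; inj₂)
open import Data.Empty using (⊥-elim)
open import Relation.Binary.PropositionalEquality
  using (_≡_; _≢_; refl; sym; trans; cong; cong₂; subst; module ≡-Reasoning)
open import Relation.Nullary using (¬_; yes; no; does)
open import Relation.Unary using (Decidable)
open import Function using (id; _∘_)

parity-double : ∀ q → parity (q * 2) ≡ 0ℙ
parity-double zero = refl
parity-double (suc q) = parity-double q

even⇒parity-0 : ∀ {n} → 2 ∣ n → parity n ≡ 0ℙ
even⇒parity-0 (divides q refl) = parity-double q

parity-0⇒even : ∀ n → parity n ≡ 0ℙ → 2 ∣ n
parity-0⇒even zero _ = 2 ∣0
parity-0⇒even (suc zero) ()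
parity-0⇒even (suc (suc n)) e with parity-0⇒even n e
... | divides q eq = divides (suc q) (cong (λ r → suc (suc r)) eq)

odd⇒pred-parity-0 : ∀ k → ¬ 2 ∣ suc k → parity k ≡ 0ℙ
odd⇒pred-parity-0 k odd with parity k in eq
... | 0ℙ = refl
... | 1ℙ = ⊥-elim (odd (parity-0⇒even (suc k) (⁻¹-injective (trans (suc-homo-⁻¹ k) eq))))

pull : ∀ {A : Set} {m} → ℕ → Vec A (suc m) → A × Vec A m
pull zero (x ∷ xs) = x , xs
pull (suc k) (x ∷ []) = x , []
pull (suc k) (x ∷ y ∷ ys) = proj₁ (pull k (y ∷ ys)) , x ∷ proj₂ (pull k (y ∷ ys))

-- By definition
-- rot (k+1) (x ∷ w) is rot k w with x inserted after its head, i.e. the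
-- vector x ∷ rot k w with its first two entries exchanged.
rot : ∀ {A : Set} {m} → ℕ → Vec A (suc m) → Vec A (suc m)
rot k v = proj₁ (pull k v) ∷ proj₂ (pull k v)

pull-head : ∀ {A : Set} {m} k (v : Vec A (suc m)) (h : k < suc m) →
            proj₁ (pull k v) ≡ lookup v (fromℕ< h)
pull-head zero (x ∷ xs) h = refl
pull-head (suc k) (x ∷ []) (s≤s ())
pull-head (suc k) (x ∷ y ∷ ys) (s≤s h) = pull-head k (y ∷ ys) h

pull-below : ∀ {A : Set} {m} k (v : Vec A (suc m)) (j : Fin m) → toℕ j < k →
             lookup (proj₂ (pull k v)) j ≡ lookup v (inject₁ j)
pull-below zero v j ()
pull-below (suc k) (x ∷ []) () _
pull-below (suc k) (x ∷ y ∷ ys) zero h = refl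
pull-below (suc k) (x ∷ y ∷ ys) (suc j) (s≤s h) = pull-below k (y ∷ ys) j h

pull-above : ∀ {A : Set} {m} k (v : Vec A (suc m)) (j : Fin m) → k ≤ toℕ j →
             lookup (proj₂ (pull k v)) j ≡ lookup v (suc j)
pull-above zero (x ∷ xs) j _ = refl
pull-above (suc k) (x ∷ []) () _
pull-above (suc k) (x ∷ y ∷ ys) zero ()
pull-above (suc k) (x ∷ y ∷ ys) (suc j) (s≤s h) = pull-above k (y ∷ ys) j h

count-swap : ∀ {A : Set} {P : A → Set} (P? : Decidable P) x y {m} (w : Vec A m) →
             count P? (x ∷ y ∷ w) ≡ count P? (y ∷ x ∷ w)
count-swap P? x y w with does (P? x) | does (P? y)
... | true | true = refl
... | true | false = refl
... | false | true = refl
... | false | false = refl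

count-rot : ∀ {A : Set} {P : A → Set} (P? : Decidable P) {m} k (v : Vec A (suc m)) →
            count P? (rot k v) ≡ count P? v
count-rot P? zero (x ∷ xs) = refl
count-rot P? (suc k) (x ∷ []) = refl
count-rot P? (suc k) (x ∷ y ∷ ys) =
  trans (count-swap P? (proj₁ (pull k (y ∷ ys))) x (proj₂ (pull k (y ∷ ys))))
        (cong (if does (P? x) then suc else id) (count-rot P? k (y ∷ ys)))

-- If exactly one of P x, Q z holds, moving x past z (with counts of P
-- taken after z and of Q after x) changes the total count by exactly one.
count-exchange : ∀ {A : Set} {P Q : A → Set} (P? : Decidable P) (Q? : Decidable Q) x z {m} (w : Vec A m) I →
                 (P x → ¬ Q z) → (¬ P x → Q z) →
                 parity (count P? (x ∷ w) + (count Q? w + I)) ≡ parity (suc (count Q? (z ∷ w) + (count P? w + I)))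
count-exchange P? Q? x z w I one-only at-least-one with P? x | Q? z
... | yes p | yes q = ⊥-elim (one-only p q)
... | yes _ | no _ = cong (parity ∘ suc) (x∙yz≈y∙xz (count P? w) (count Q? w) I)
... | no _ | yes _ = cong parity (x∙yz≈y∙xz (count P? w) (count Q? w) I)
... | no p | no q = ⊥-elim (q (at-least-one p))

-- Exchanging two distinct leading entries changes the number of
-- inversions by exactly one, hence flips its parity.
inversions-swap : ∀ {n m} {x z : Fin n} (w : Vec (Fin n) m) → x ≢ z →
                  parity (inversions (z ∷ x ∷ w)) ≡ parity (suc (inversions (x ∷ z ∷ w)))
inversions-swap {x = x} {z} w x≢z =
  count-exchange (_<ᶠ? z) (_<ᶠ? x) x z w (inversions w) <-asym
    (λ x≮z → ≤∧≢⇒< (≮⇒≥ x≮z) (x≢z ∘ sym ∘ toℕ-injective))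

Distinct : ∀ {A : Set} {m} → Vec A m → Set
Distinct v = ∀ i j → lookup v i ≡ lookup v j → i ≡ j

-- Moving the entry at position k to the front is a product of k adjacent
-- transpositions, so it changes the parity of the inversion number by k.
inversions-rot : ∀ {n m} k (v : Vec (Fin n) (suc m)) → k < suc m → Distinct v →
                 parity (inversions (rot k v)) ≡ parity (k + inversions v)
inversions-rot zero (x ∷ xs) _ _ = refl
inversions-rot (suc k) (x ∷ []) (s≤s ()) _
inversions-rot {n} {suc m} (suc k) (x ∷ w@(y ∷ ys)) (s≤s h) distinct = begin
  parity (inversions (z ∷ x ∷ zs))          ≡⟨ inversions-swap zs x≢z ⟩
  parity (suc (count (_<ᶠ? x) (rot k w) + inversions (rot k w)))
    ≡⟨ cong (λ c → parity (suc (c + inversions (rot k w)))) (count-rot (_<ᶠ? x) k w) ⟩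
  parity (suc c + inversions (rot k w))      ≡⟨ +-homo-+ (suc c) (inversions (rot k w)) ⟩
  parity (suc c) ℙ.+ parity (inversions (rot k w))
    ≡⟨ cong (parity (suc c) ℙ.+_) (inversions-rot k w h (λ i j e → fsuc-injective (distinct (suc i) (suc j) e))) ⟩
  parity (suc c) ℙ.+ parity (k + inversions w) ≡⟨ +-homo-+ (suc c) (k + inversions w) ⟨
  parity (suc c + (k + inversions w))        ≡⟨ cong (parity ∘ suc) (x∙yz≈y∙xz c k (inversions w)) ⟩
  parity (suc k + (c + inversions w))        ∎
  where
  open ≡-Reasoning
  z : Fin n
  z = proj₁ (pull k w)
  zs : Vec (Fin n) m
  zs = proj₂ (pull k w)
  c : ℕ
  c = count (_<ᶠ? x) w
  x≢z : x ≢ z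
  x≢z e with distinct zero (suc (fromℕ< h)) (trans e (pull-head k w h))
  ... | ()

tau-zero : ∀ {m} k (h : k < suc m) → tau {suc m} (suc k) zero ≡ fromℕ< h
tau-zero {m} k h with k <ℕ? suc m
... | yes _ = refl
... | no k≮ = ⊥-elim (k≮ h)

tau-below : ∀ {m} k (j : Fin m) → toℕ (suc j) < k → tau {suc m} k (suc j) ≡ inject₁ j
tau-below k j h with toℕ (suc j) <ℕ? k
... | yes _ = refl
... | no j≮k = ⊥-elim (j≮k h)

tau-above : ∀ {m} k (j : Fin m) → k ≤ toℕ (suc j) → tau {suc m} k (suc j) ≡ suc j
tau-above k j h with toℕ (suc j) <ℕ? k
... | yes j<k = ⊥-elim (<⇒≱ j<k h)
... | no _ = refl

·τ-lookup : ∀ {n} (σ : Word n) k p → lookup (σ ·τ k) p ≡ lookup σ (tau k p)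
·τ-lookup σ k = lookup∘tabulate (λ p → lookup σ (tau k p))

·τ-rot : ∀ {m} (σ : Word (suc m)) k → k < suc m → σ ·τ suc k ≡ rot k σ
·τ-rot σ k h = trans (tabulate-cong entry) (tabulate∘lookup (rot k σ))
  where
  entry : ∀ p → lookup σ (tau (suc k) p) ≡ lookup (rot k σ) p
  entry zero = trans (cong (lookup σ) (tau-zero k h)) (sym (pull-head k σ h))
  entry (suc j) with toℕ j <ℕ? k
  ... | yes j<k = trans (cong (lookup σ) (tau-below (suc k) j (s≤s j<k))) (sym (pull-below k σ j j<k))
  ... | no j≮k = trans (cong (lookup σ) (tau-above (suc k) j (s≤s (≮⇒≥ j≮k)))) (sym (pull-above k σ j (≮⇒≥ j≮k)))

tau-suc-cases : ∀ {m} k (j : Fin m) →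
                (toℕ j < k × toℕ (tau {suc m} (suc k) (suc j)) ≡ toℕ j)
                ⊎ (k ≤ toℕ j × toℕ (tau {suc m} (suc k) (suc j)) ≡ suc (toℕ j))
tau-suc-cases k j with toℕ j <ℕ? k
... | yes j<k = inj₁ (j<k , trans (cong toℕ (tau-below (suc k) j (s≤s j<k))) (toℕ-inject₁ j))
... | no j≮k = inj₂ (≮⇒≥ j≮k , cong toℕ (tau-above (suc k) j (s≤s (≮⇒≥ j≮k))))

tau-suc-≢ : ∀ {m} k (j : Fin m) → toℕ (tau {suc m} (suc k) (suc j)) ≢ k
tau-suc-≢ k j e with tau-suc-cases k j
... | inj₁ (j<k , t≡j) = <⇒≢ j<k (trans (sym t≡j) e)
... | inj₂ (k≤j , t≡1+j) = 1+n≰n (subst (_≤ toℕ j) (sym (trans (sym t≡1+j) e)) k≤j)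

-- τ_{k+1} is injective: position 1 is the only preimage of k+1, and the
-- images of positions below and above k+1 lie on different sides of it.
tau-injective : ∀ {m} k → k < suc m → (p q : Fin (suc m)) →
                tau {suc m} (suc k) p ≡ tau (suc k) q → p ≡ q
tau-injective k h zero zero e = refl
tau-injective k h zero (suc j) e =
  ⊥-elim (tau-suc-≢ k j (trans (cong toℕ (sym e)) (trans (cong toℕ (tau-zero k h)) (toℕ-fromℕ< h))))
tau-injective k h (suc i) zero e =
  ⊥-elim (tau-suc-≢ k i (trans (cong toℕ e) (trans (cong toℕ (tau-zero k h)) (toℕ-fromℕ< h))))
tau-injective k h (suc i) (suc j) e with tau-suc-cases k i | tau-suc-cases k j
... | inj₁ (_ , ti) | inj₁ (_ , tj) = cong suc (toℕ-injective (trans (sym ti) (trans (cong toℕ e) tj)))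
... | inj₂ (_ , ti) | inj₂ (_ , tj) = cong suc (toℕ-injective (suc-injective (trans (sym ti) (trans (cong toℕ e) tj))))
... | inj₁ (i<k , ti) | inj₂ (k≤j , tj) =
  ⊥-elim (<⇒≱ i<k (subst (k ≤_) (sym (trans (sym ti) (trans (cong toℕ e) tj))) (m≤n⇒m≤1+n k≤j)))
... | inj₂ (k≤i , ti) | inj₁ (j<k , tj) =
  ⊥-elim (<⇒≱ j<k (subst (k ≤_) (trans (sym ti) (trans (cong toℕ e) tj)) (m≤n⇒m≤1+n k≤i)))

-- For odd k, τ_k is an even rotation, so σ τ_k is even whenever σ is.
τ-preserves-A : ∀ {m} (σ : Word (suc m)) k → OddGen (suc m) k → InA σ → InA (σ ·τ k)
τ-preserves-A σ zero (() , _) _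
τ-preserves-A σ (suc k) (_ , h , odd) (perm , even) = perm′ , even′
  where
  perm′ : IsPerm (σ ·τ suc k)
  perm′ p q e = tau-injective k h p q (perm _ _ (trans (sym (·τ-lookup σ (suc k) p)) (trans e (·τ-lookup σ (suc k) q))))
  parity-0 : parity (inversions (rot k σ)) ≡ 0ℙ
  parity-0 = begin
    parity (inversions (rot k σ))           ≡⟨ inversions-rot k σ h perm ⟩
    parity (k + inversions σ)               ≡⟨ +-homo-+ k (inversions σ) ⟩
    parity k ℙ.+ parity (inversions σ)      ≡⟨ cong₂ ℙ._+_ (odd⇒pred-parity-0 k odd) (even⇒parity-0 even) ⟩
    0ℙ                                      ∎
    where open ≡-Reasoning
  even′ : 2 ∣ inversions (σ ·τ suc k)
  even′ = subst (λ w → 2 ∣ inversions w) (sym (·τ-rot σ k h)) (parity-0⇒even _ parity-0)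

count-none : ∀ {A : Set} {P : A → Set} (P? : Decidable P) {m} (g : Fin m → A) →
             (∀ j → ¬ P (g j)) → count P? (tabulate g) ≡ 0
count-none P? {zero} g none = refl
count-none P? {suc m} g none with P? (g zero)
... | yes p = ⊥-elim (none zero p)
... | no _ = count-none P? (g ∘ suc) (none ∘ suc)

inversions-monotone : ∀ {n m} (f : Fin m → Fin n) →
                      (∀ {i j} → toℕ i ≤ toℕ j → toℕ (f i) ≤ toℕ (f j)) → inversions (tabulate f) ≡ 0
inversions-monotone {m = zero} f mono = refl
inversions-monotone {m = suc m} f mono =
  cong₂ _+_ (count-none (_<ᶠ? f zero) (f ∘ suc) (λ j → ≤⇒≯ (mono z≤n)))
            (inversions-monotone (f ∘ suc) (mono ∘ s≤s))

identity-A : ∀ n → InA (allFin n)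
identity-A n =
  (λ i j e → trans (sym (lookup-allFin i)) (trans e (lookup-allFin j))) ,
  subst (2 ∣_) (sym (inversions-monotone {n} {n} id id)) (2 ∣0)

last : ∀ {m} → Fin (suc m)
last {m} = fromℕ m

τn-lookup-suc : ∀ {m} (σ : Word (suc m)) (j : Fin m) → lookup (σ ·τ suc m) (suc j) ≡ lookup σ (inject₁ j)
τn-lookup-suc {m} σ j = trans (·τ-lookup σ (suc m) (suc j)) (cong (lookup σ) (tau-below (suc m) j (s≤s (toℕ<n j))))

τn-power-lookup : ∀ {m} (σ : Word (suc m)) t (p q : Fin (suc m)) → toℕ q + t ≡ toℕ p →
                  lookup (iter (_·τ suc m) t σ) p ≡ lookup σ q
τn-power-lookup σ zero p q e = cong (lookup σ) (toℕ-injective (trans (sym e) (+-identityʳ (toℕ q))))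
τn-power-lookup σ (suc t) zero q e with trans (sym (+-suc (toℕ q) t)) e
... | ()
τn-power-lookup {m} σ (suc t) (suc p) q e =
  trans (τn-lookup-suc (iter (_·τ suc m) t σ) p)
        (τn-power-lookup σ t (inject₁ p) q (trans (suc-injective (trans (sym (+-suc _ _)) e)) (sym (toℕ-inject₁ p))))

τn-power-A : ∀ {m} t (σ : Word (suc m)) → OddGen (suc m) (suc m) → InA σ → InA (iter (_·τ suc m) t σ)
τn-power-A zero σ odd a = a
τn-power-A {m} (suc t) σ odd a = τ-preserves-A (iter (_·τ suc m) t σ) (suc m) odd (τn-power-A t σ odd a)

-- For odd n ≥ 3, every value i is the last entry of an even permutation,
-- namely of id · τ_n^(n-i).
τn-power-reaching : ∀ {m} → OddGen (suc m) (suc m) → (i : Fin (suc m)) →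
                    ∃ λ π → InA π × lookup π last ≡ i
τn-power-reaching {m} odd i =
  π₀ , τn-power-A (m ∸ toℕ i) (allFin (suc m)) odd (identity-A (suc m)) ,
  trans (τn-power-lookup (allFin (suc m)) (m ∸ toℕ i) last i shift) (lookup-allFin i)
  where
  π₀ : Word (suc m)
  π₀ = iter (_·τ suc m) (m ∸ toℕ i) (allFin (suc m))
  shift : toℕ i + (m ∸ toℕ i) ≡ toℕ (last {m})
  shift = trans (m+[n∸m]≡n (≤-pred (toℕ<n i))) (sym (toℕ-fromℕ m))

-- τ_n changes the last entry of a permutation: it becomes π(n-1).
τn-moves-last : ∀ {m} (π : Word (suc (suc m))) → IsPerm π → lookup (π ·τ suc (suc m)) last ≢ lookup π last
τn-moves-last {m} π perm e = <-irrefl positions-equal (n<1+n _)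
  where
  positions-equal : toℕ (fromℕ m) ≡ toℕ (last {suc m})
  positions-equal = trans (sym (toℕ-inject₁ (fromℕ m)))
    (cong toℕ (perm _ _ (trans (sym (τn-lookup-suc π (fromℕ m))) e)))

·τ-fixes-last : ∀ {m} (σ : Word (suc (suc m))) k → k < suc (suc m) →
                lookup (σ ·τ k) last ≡ lookup σ last
·τ-fixes-last {m} σ k (s≤s k≤) =
  trans (·τ-lookup σ k last)
        (cong (lookup σ) (tau-above k (fromℕ m) (subst (k ≤_) (cong suc (sym (toℕ-fromℕ m))) k≤)))

module Walk {m : ℕ} (C : HamCycle (suc (suc m))) where
  open HamCycle C

  iter-A : ∀ t σ → InA σ → InA (iter next t σ)
  iter-A zero σ a = a
  iter-A (suc t) σ a with isEdge (iter next t σ) (iter-A t σ a)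
  ... | k , odd , eq = subst InA (sym eq) (τ-preserves-A (iter next t σ) k odd (iter-A t σ a))

  last-changes⇒τn : ∀ π → InA π → lookup (next π) last ≢ lookup π last → next π ≡ π ·τ suc (suc m)
  last-changes⇒τn π a changes with isEdge π a
  ... | k , (_ , k≤n , _) , eq with k <ℕ? suc (suc m)
  ...   | yes k<n = ⊥-elim (changes (trans (cong (λ w → lookup w last) eq) (·τ-fixes-last π k k<n)))
  ...   | no k≮n = subst (λ k′ → next π ≡ π ·τ k′) (≤-antisym k≤n (≮⇒≥ k≮n)) eq

  leaves-by-τn : ∀ t σ → InA σ → lookup (iter next t σ) last ≢ lookup σ last →
                 ∃ λ π → InA π × lookup π last ≡ lookup σ last × next π ≡ π ·τ suc (suc m)
  leaves-by-τn zero σ a differs = ⊥-elim (differs refl)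
  leaves-by-τn (suc t) σ a differs with lookup (iter next t σ) last ≟ᶠ lookup σ last
  ... | no differs′ = leaves-by-τn t σ a differs′
  ... | yes same = iter next t σ , iter-A t σ a , same ,
                   last-changes⇒τn (iter next t σ) (iter-A t σ a) (λ e → differs (trans e same))

lemma5 : (n : ℕ) → 3 ≤ n → ¬ (2 ∣ n) → (C : HamCycle n) → (i : Fin n) →
    ∃ λ π → InA π × LastValue π i × HamCycle.next C π ≡ π ·τ n
lemma5 (suc (suc (suc m))) (s≤s (s≤s (s≤s z≤n))) odd C i =
  let (π₀ , π₀-A , π₀-last) = τn-power-reaching τn-odd i
      ρ = π₀ ·τ N
      (t , π₀↝ρ) = HamCycle.covers C π₀ ρ π₀-A (τ-preserves-A π₀ N τn-odd π₀-A)
      last-changes = τn-moves-last π₀ (proj₁ π₀-A) ∘ trans (cong (λ w → lookup w last) (sym π₀↝ρ))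
      (π , π-A , π-last , π-edge) = leaves-by-τn t π₀ π₀-A last-changes
  in π , π-A , (last , toℕ-fromℕ _ , trans π-last π₀-last) , π-edge
  where
  open Walk C
  N : ℕ
  N = suc (suc (suc m))
  τn-odd : OddGen N N
  τn-odd = s≤s (s≤s (s≤s z≤n)) , ≤-refl , odd
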